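{- For integers $0<k\le m\le n$, the total weight of the free Schröder paths of length $2n$ with $m$ flaws and $k$ flaw blocks equals \[a(m-k,k)\cdot\big[a(n-m,k+1)+a(n-m,k)\big],\] where each free Schröder path is given weight $2$ if it ends with an up step and weight $1$ otherwise.
   Context: A free Schröder path of length $2n$ is a lattice path from $(0,0)$ to $(2n,0)$ with steps $U=(1,1)$, $H=(2,0)$, $D=(1,-1)$. It has $m$ flaws if the total number of $U$ and $H$ steps lying below the $x$-axis (a $U$ step from height $-j$ to $-j+1$, or an $H$ step at height $-j$, $j\ge1$) equals $m$. A flaw block is a maximal segment that starts and ends on the $x$-axis and is otherwise strictly below it; their number equals the number of $D$ steps from height $0$ to $-1$. Let $S=S(x)$ be the power series determined by $S=1+xS+xS^2$ (the generating function of the large Schröder numbers $1,2,6,22,\dots$), and let $a(n,k)=[x^n]S^k$, the coefficient of $x^n$ in $S^k$ (so $a(0,k)=1$). -}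

module Defs where

open import Data.Nat using (ℕ; zero; suc; _+_; _*_; _∸_; _≡ᵇ_)
open import Data.Integer as ℤ using (ℤ; 0ℤ; -1ℤ; 1ℤ)
open import Data.List using (List; []; _∷_; map; _++_; filter; applyUpTo; last)
open import Data.Nat.ListAction using (sum)
open import Data.Maybe using (Maybe; just; nothing)
open import Data.Bool using (Bool; true; false; if_then_else_; _∧_)
open import Relation.Binary.PropositionalEquality using (_≡_)
open import Relation.Nullary.Decidable using (Dec)
import Data.Nat as ℕ
import Data.Integer.Properties as ℤP
import Data.Nat.Properties as ℕP

data Step : Set where
  U H D : Step

stepLen : Step → ℕ
stepLen U = 1
stepLen H = 2
stepLen D = 1

stepΔ : Step → ℤ
stepΔ U = 1ℤ
stepΔ H = 0ℤ
stepΔ D = -1ℤ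

stepSeqs : ℕ → List (List Step)
stepSeqs zero = [] ∷ []
stepSeqs (suc zero) = (U ∷ []) ∷ (D ∷ []) ∷ []
stepSeqs (suc (suc L)) =
  map (U ∷_) (stepSeqs (suc L)) ++ map (D ∷_) (stepSeqs (suc L)) ++ map (H ∷_) (stepSeqs L)

endHeight : ℤ → List Step → ℤ
endHeight h [] = h
endHeight h (s ∷ p) = endHeight (h ℤ.+ stepΔ s) p

freeSchroeder : ℕ → List (List Step)
freeSchroeder n = filter (λ p → endHeight 0ℤ p ℤ.≟ 0ℤ) (stepSeqs (2 * n))

below : ℤ → Bool
below h = Relation.Nullary.Decidable.⌊ h ℤ.<? 0ℤ ⌋
  where import Relation.Nullary.Decidable

flawsFrom : ℤ → List Step → ℕ
flawsFrom h [] = 0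
flawsFrom h (U ∷ p) = (if below h then 1 else 0) + flawsFrom (h ℤ.+ 1ℤ) p
flawsFrom h (H ∷ p) = (if below h then 1 else 0) + flawsFrom h p
flawsFrom h (D ∷ p) = flawsFrom (h ℤ.+ -1ℤ) p

flaws : List Step → ℕ
flaws = flawsFrom 0ℤ

isZero : ℤ → Bool
isZero h = Relation.Nullary.Decidable.⌊ h ℤ.≟ 0ℤ ⌋
  where import Relation.Nullary.Decidable

-- number of flaw blocks = number of D steps from height 0 to height -1
blocksFrom : ℤ → List Step → ℕ
blocksFrom h [] = 0
blocksFrom h (U ∷ p) = blocksFrom (h ℤ.+ 1ℤ) p
blocksFrom h (H ∷ p) = blocksFrom h p
blocksFrom h (D ∷ p) = (if isZero h then 1 else 0) + blocksFrom (h ℤ.+ -1ℤ) p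

flawBlocks : List Step → ℕ
flawBlocks = blocksFrom 0ℤ

weight : List Step → ℕ
weight p with last p
... | just U = 2
... | _      = 1

totalWeight : ℕ → ℕ → ℕ → ℕ
totalWeight n m k =
  sum (map weight (filter (λ p → (flaws p ℕ.≟ m) Relation.Nullary.Decidable.×-dec (flawBlocks p ℕ.≟ k))
                          (freeSchroeder n)))
  where import Relation.Nullary.Decidable

Series : Set
Series = ℕ → ℕ

_⊛_ : Series → Series → Series
(f ⊛ g) n = sum (applyUpTo (λ i → f i * g (n ∸ i)) (suc n))

one : Series
one zero = 1
one (suc _) = 0

xTimes : Series → Series
xTimes f zero = 0
xTimes f (suc n) = f n

schroederStep : Series → Series
schroederStep T n = one n + xTimes T n + xTimes (T ⊛ T) n

-- j-fold iterate of schroederStep from 0; its coefficients of x^i for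
-- i < j agree with those of the unique solution S of S = 1 + xS + xS²
schroederIter : ℕ → Series
schroederIter zero _ = 0
schroederIter (suc j) = schroederStep (schroederIter j)

-- S(x): the power series with S = 1 + xS + xS² (large Schröder numbers)
S : Series
S n = schroederIter (suc n) n

S^ : ℕ → Series
S^ zero = one
S^ (suc k) = S ⊛ S^ k

a : ℕ → ℕ → ℕ
a n k = S^ k n

-- Generalise the total weight to count L h m k: step sequences of length L that start at
-- height h and end on the axis, with m flaws and k flaw blocks measured against the axis.
-- Removing the first step gives a recurrence in L (a U or H step below the axis is a flaw,
-- a D step leaving the axis opens a block) which, with the cases L = 0 and L = 1, determines
-- count.  Explicit products of coefficients a(n,k), given separately for start heights d ≥ 0
-- and -(e+1), satisfy the same recurrence because of
--   a(n+1,r+1) = a(n,r+2) + a(n+1,r) + a(n,r+1),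
-- the coefficient of x^(n+1) in S·S^r = S^r + x S^(r+1) + x S^(r+2).  At h = 0, L = 2n the
-- product is the claimed one.

module Submission where

open import Defs
open import Data.Nat using (ℕ; zero; suc; _+_; _*_; _∸_; _≤_; _<_; z≤n; s≤s; _≡ᵇ_)
open import Data.Nat.Properties
open import Data.Nat.Tactic.RingSolver using (solve-∀)
open import Data.Sum using (inj₁; inj₂)
open import Data.Integer as ℤ using (ℤ; -[1+_]; 0ℤ; 1ℤ; -1ℤ)
import Data.Integer.Properties as ℤP
open import Data.Bool using (Bool; true; false; if_then_else_; _∧_)
open import Data.List using (List; []; _∷_; map; _++_; filter; last)
open import Data.List.Properties using (map-++; map-∘; map-cong; map-cong-local)
open import Data.List.Relation.Unary.All as All using (All; universal)
open import Data.List.Relation.Unary.All.Properties using (++⁺; map⁺)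
open import Data.Nat.ListAction using (sum)
open import Data.Nat.ListAction.Properties using (sum-++)
open import Data.Maybe using (Maybe; just; nothing)
import Data.Maybe as Maybe
open import Data.Empty using (⊥-elim)
open import Function using (_∘_)
open import Relation.Unary using (Decidable)
open import Relation.Nullary.Decidable using (does; isYes≗does)
open import Relation.Binary.PropositionalEquality

infixl 6 _⊕_

_⊕_ : Series → Series → Series
(f ⊕ g) n = f n + g n

scale : ℕ → Series → Series
scale c f n = c * f n

tail : Series → Series
tail f n = f (suc n)

-- (f ⊛ g) (suc n) unfolds definitionally to f 0 * g (suc n) + (tail f ⊛ g) n.

⊛-cong-≤ : ∀ {f f′ g g′} n →
           (∀ {i} → i ≤ n → f i ≡ f′ i) → (∀ {i} → i ≤ n → g i ≡ g′ i) → (f ⊛ g) n ≡ (f′ ⊛ g′) n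
⊛-cong-≤ zero f≡ g≡ = cong (_+ 0) (cong₂ _*_ (f≡ z≤n) (g≡ z≤n))
⊛-cong-≤ (suc n) f≡ g≡ = cong₂ _+_ (cong₂ _*_ (f≡ z≤n) (g≡ ≤-refl))
  (⊛-cong-≤ n (λ i≤n → f≡ (s≤s i≤n)) (λ i≤n → g≡ (m≤n⇒m≤1+n i≤n)))

⊛-congʳ : ∀ {f f′} g → f ≗ f′ → f ⊛ g ≗ f′ ⊛ g
⊛-congʳ g f≗f′ n = ⊛-cong-≤ {g′ = g} n (λ {i} _ → f≗f′ i) (λ _ → refl)

private
  distrib-interchange : ∀ a b c x y → (a + b) * c + (x + y) ≡ (a * c + x) + (b * c + y)
  distrib-interchange = solve-∀

  scale-factor : ∀ c a b x → c * a * b + c * x ≡ c * (a * b + x)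
  scale-factor = solve-∀

  ⊛-assoc-head : ∀ a b c x y → (a * b + 0) * c + (a * x + y) ≡ a * (b * c + x) + y
  ⊛-assoc-head = solve-∀

  ⊛-assoc-zero : ∀ a b c → (a * b + 0) * c + 0 ≡ a * (b * c + 0) + 0
  ⊛-assoc-zero = solve-∀

⊛-distribʳ-⊕ : ∀ f g h → (f ⊕ g) ⊛ h ≗ f ⊛ h ⊕ g ⊛ h
⊛-distribʳ-⊕ f g h zero = distrib-interchange (f 0) (g 0) (h 0) 0 0
⊛-distribʳ-⊕ f g h (suc n) = trans
  (cong ((f 0 + g 0) * h (suc n) +_) (⊛-distribʳ-⊕ (tail f) (tail g) h n))
  (distrib-interchange (f 0) (g 0) (h (suc n)) _ _)

xTimes-⊛ : ∀ f g → xTimes f ⊛ g ≗ xTimes (f ⊛ g)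
xTimes-⊛ f g zero = refl
xTimes-⊛ f g (suc n) = refl

scale-⊛ : ∀ c f g → scale c f ⊛ g ≗ scale c (f ⊛ g)
scale-⊛ c f g zero = trans (cong (c * f 0 * g 0 +_) (sym (*-zeroʳ c))) (scale-factor c (f 0) (g 0) 0)
scale-⊛ c f g (suc n) = trans
  (cong (c * f 0 * g (suc n) +_) (scale-⊛ c (tail f) g n))
  (scale-factor c (f 0) (g (suc n)) _)

⊛-assoc : ∀ f g h → (f ⊛ g) ⊛ h ≗ f ⊛ (g ⊛ h)
⊛-assoc f g h zero = ⊛-assoc-zero (f 0) (g 0) (h 0)
⊛-assoc f g h (suc n) = begin
  (f 0 * g 0 + 0) * h (suc n) + ((scale (f 0) (tail g) ⊕ tail f ⊛ g) ⊛ h) n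
    ≡⟨ cong ((f 0 * g 0 + 0) * h (suc n) +_) (⊛-distribʳ-⊕ (scale (f 0) (tail g)) (tail f ⊛ g) h n) ⟩
  (f 0 * g 0 + 0) * h (suc n) + ((scale (f 0) (tail g) ⊛ h) n + ((tail f ⊛ g) ⊛ h) n)
    ≡⟨ cong ((f 0 * g 0 + 0) * h (suc n) +_)
            (cong₂ _+_ (scale-⊛ (f 0) (tail g) h n) (⊛-assoc (tail f) g h n)) ⟩
  (f 0 * g 0 + 0) * h (suc n) + (f 0 * (tail g ⊛ h) n + (tail f ⊛ (g ⊛ h)) n)
    ≡⟨ ⊛-assoc-head (f 0) (g 0) (h (suc n)) _ _ ⟩
  (f ⊛ (g ⊛ h)) (suc n) ∎
  where open ≡-Reasoning

one-⊛ : ∀ f → one ⊛ f ≗ f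
one-⊛ f zero = trans (+-identityʳ _) (*-identityˡ (f 0))
one-⊛ f (suc n) = trans (cong (1 * f (suc n) +_) (zero-⊛ n)) (trans (+-identityʳ _) (*-identityˡ _))
  where
  zero-⊛ : ∀ n → ((λ _ → 0) ⊛ f) n ≡ 0
  zero-⊛ zero = refl
  zero-⊛ (suc n) = zero-⊛ n

schroederIter-stable : ∀ {i j} → i < j → schroederIter (suc j) i ≡ schroederIter j i
schroederIter-stable {zero} {suc j} _ = refl
schroederIter-stable {suc i} {suc j} (s≤s i<j) = cong₂ _+_ (schroederIter-stable i<j)
  (⊛-cong-≤ i stable stable)
  where
  stable : ∀ {t} → t ≤ i → schroederIter (suc j) t ≡ schroederIter j t
  stable t≤i = schroederIter-stable (≤-<-trans t≤i i<j)

schroederIter≡S : ∀ {i j} → i < j → schroederIter j i ≡ S i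
schroederIter≡S {i} {suc j} i<1+j with m<1+n⇒m<n∨m≡n i<1+j
... | inj₁ i<j = trans (schroederIter-stable i<j) (schroederIter≡S i<j)
... | inj₂ refl = refl

S-fixpoint : S ≗ one ⊕ xTimes S ⊕ xTimes (S ⊛ S)
S-fixpoint zero = refl
S-fixpoint (suc n) = cong₂ _+_ (schroederIter≡S {n} ≤-refl)
  (⊛-cong-≤ n converged converged)
  where
  converged : ∀ {i} → i ≤ n → schroederIter (suc n) i ≡ S i
  converged i≤n = schroederIter≡S (s≤s i≤n)

a-zero : ∀ r → a 0 r ≡ 1
a-zero zero = refl
a-zero (suc r) = cong (λ x → 1 * x + 0) (a-zero r)

a-suc-suc : ∀ n r → a (suc n) (suc r) ≡ a n (suc (suc r)) + a (suc n) r + a n (suc r)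
a-suc-suc n r = begin
  (S ⊛ P) (suc n)
    ≡⟨ ⊛-congʳ P S-fixpoint (suc n) ⟩
  ((one ⊕ xTimes S ⊕ xTimes (S ⊛ S)) ⊛ P) (suc n)
    ≡⟨ ⊛-distribʳ-⊕ (one ⊕ xTimes S) (xTimes (S ⊛ S)) P (suc n) ⟩
  ((one ⊕ xTimes S) ⊛ P) (suc n) + (xTimes (S ⊛ S) ⊛ P) (suc n)
    ≡⟨ cong (_+ (xTimes (S ⊛ S) ⊛ P) (suc n)) (⊛-distribʳ-⊕ one (xTimes S) P (suc n)) ⟩
  (one ⊛ P) (suc n) + (xTimes S ⊛ P) (suc n) + (xTimes (S ⊛ S) ⊛ P) (suc n)
    ≡⟨ cong₂ (λ x y → x + (S ⊛ P) n + y) (one-⊛ P (suc n)) (⊛-assoc S S P n) ⟩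
  P (suc n) + (S ⊛ P) n + (S ⊛ (S ⊛ P)) n
    ≡⟨ rotate (P (suc n)) ((S ⊛ P) n) ((S ⊛ (S ⊛ P)) n) ⟩
  (S ⊛ (S ⊛ P)) n + P (suc n) + (S ⊛ P) n ∎
  where
  open ≡-Reasoning
  P = S^ r
  rotate : ∀ x y z → x + y + z ≡ z + x + y
  rotate = solve-∀

xTimesIf : Bool → Series → Series
xTimesIf false f = f
xTimesIf true f = xTimes f

xTimesIf-cong : ∀ b {f g} → f ≗ g → xTimesIf b f ≗ xTimesIf b g
xTimesIf-cong false f≗g n = f≗g n
xTimesIf-cong true f≗g zero = refl
xTimesIf-cong true f≗g (suc n) = f≗g n

sum-xTimesIf : ∀ {A : Set} b (g : ℕ → A → ℕ) n xs →
  sum (map (λ x → xTimesIf b (λ n′ → g n′ x) n) xs) ≡ xTimesIf b (λ n′ → sum (map (g n′) xs)) n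
sum-xTimesIf false g n xs = refl
sum-xTimesIf true g (suc n) xs = refl
sum-xTimesIf true g zero [] = refl
sum-xTimesIf true g zero (x ∷ xs) = sum-xTimesIf true g zero xs

xTimes-0 : ∀ n → xTimes (λ _ → 0) n ≡ 0
xTimes-0 zero = refl
xTimes-0 (suc n) = refl

FirstStepRecurrence : (ℕ → ℤ → ℕ → ℕ → ℕ) → Set
FirstStepRecurrence F = ∀ L h m k → F (2 + L) h m k ≡
    xTimesIf (below h) (λ m′ → F (1 + L) (h ℤ.+ 1ℤ) m′ k) m
  + xTimesIf (isZero h) (λ k′ → F (1 + L) (h ℤ.+ -1ℤ) m k′) k
  + xTimesIf (below h) (λ m′ → F L h m′ k) m

firstStepRecurrence-determined : ∀ {F G} → FirstStepRecurrence F → FirstStepRecurrence G →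
  (∀ h m k → F 0 h m k ≡ G 0 h m k) → (∀ h m k → F 1 h m k ≡ G 1 h m k) →
  ∀ L h m k → F L h m k ≡ G L h m k
firstStepRecurrence-determined {F} {G} F-rec G-rec F≡G₀ F≡G₁ = go
  where
  go : ∀ L h m k → F L h m k ≡ G L h m k
  go zero = F≡G₀
  go (suc zero) = F≡G₁
  go (suc (suc L)) h m k = trans (F-rec L h m k) (trans
    (cong₂ _+_ (cong₂ _+_ (xTimesIf-cong (below h) (λ m′ → go (suc L) _ m′ k) m)
                          (xTimesIf-cong (isZero h) (λ k′ → go (suc L) _ m k′) k))
               (xTimesIf-cong (below h) (λ m′ → go L h m′ k) m))
    (sym (G-rec L h m k)))

weight-∷ : ∀ s y ys → weight (s ∷ y ∷ ys) ≡ weight (y ∷ ys)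
weight-∷ s y ys with last (y ∷ ys)
... | just U = refl
... | just H = refl
... | just D = refl
... | nothing = refl

weight-H∷ : ∀ p → weight (H ∷ p) ≡ weight p
weight-H∷ [] = refl
weight-H∷ (y ∷ ys) = weight-∷ H y ys

weight-D∷ : ∀ p → weight (D ∷ p) ≡ weight p
weight-D∷ [] = refl
weight-D∷ (y ∷ ys) = weight-∷ D y ys

selectedWeight : Bool → ℕ → ℕ → ℕ → ℕ → ℕ → ℕ
selectedWeight onAxis flawCount blockCount m k w =
  if onAxis then (if flawCount ≡ᵇ m then (if blockCount ≡ᵇ k then w else 0) else 0) else 0

selectedWeight-flaw : ∀ z c f b m k w →
  selectedWeight z ((if c then 1 else 0) + f) b m k w ≡ xTimesIf c (λ m′ → selectedWeight z f b m′ k w) m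
selectedWeight-flaw z false f b m k w = refl
selectedWeight-flaw false true f b zero k w = refl
selectedWeight-flaw true true f b zero k w = refl
selectedWeight-flaw z true f b (suc m) k w = refl

selectedWeight-block : ∀ z f c b m k w →
  selectedWeight z f ((if c then 1 else 0) + b) m k w ≡ xTimesIf c (λ k′ → selectedWeight z f b m k′ w) k
selectedWeight-block z f false b m k w = refl
selectedWeight-block false f true b m zero w = refl
selectedWeight-block true f true b m zero w with f ≡ᵇ m
... | true = refl
... | false = refl
selectedWeight-block z f true b m (suc k) w = refl

countedWeight : ℤ → ℕ → ℕ → List Step → ℕ
countedWeight h m k p = selectedWeight (isZero (endHeight h p)) (flawsFrom h p) (blocksFrom h p) m k (weight p)

-- The one-step path U has weight 2, not the weight 1 of [].
countedWeight-U∷ : ∀ h m k {p} → p ≢ [] →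
  countedWeight h m k (U ∷ p) ≡ xTimesIf (below h) (λ m′ → countedWeight (h ℤ.+ 1ℤ) m′ k p) m
countedWeight-U∷ h m k {[]} p≢[] = ⊥-elim (p≢[] refl)
countedWeight-U∷ h m k {p@(y ∷ ys)} _ rewrite weight-∷ U y ys =
  selectedWeight-flaw (isZero (endHeight h′ p)) (below h) (flawsFrom h′ p) (blocksFrom h′ p) m k (weight p)
  where h′ = h ℤ.+ 1ℤ

countedWeight-H∷ : ∀ h m k p →
  countedWeight h m k (H ∷ p) ≡ xTimesIf (below h) (λ m′ → countedWeight h m′ k p) m
countedWeight-H∷ h m k p rewrite weight-H∷ p | ℤP.+-identityʳ h =
  selectedWeight-flaw (isZero (endHeight h p)) (below h) (flawsFrom h p) (blocksFrom h p) m k (weight p)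

countedWeight-D∷ : ∀ h m k p →
  countedWeight h m k (D ∷ p) ≡ xTimesIf (isZero h) (λ k′ → countedWeight (h ℤ.+ -1ℤ) m k′ p) k
countedWeight-D∷ h m k p rewrite weight-D∷ p =
  selectedWeight-block (isZero (endHeight h′ p)) (flawsFrom h′ p) (isZero h) (blocksFrom h′ p) m k (weight p)
  where h′ = h ℤ.+ -1ℤ

sum-map-++ : ∀ {A : Set} (f : A → ℕ) xs ys → sum (map f (xs ++ ys)) ≡ sum (map f xs) + sum (map f ys)
sum-map-++ f xs ys = trans (cong sum (map-++ f xs ys)) (sum-++ (map f xs) (map f ys))

stepSeqs-≢[] : ∀ L → All (_≢ []) (stepSeqs (suc L))
stepSeqs-≢[] zero = (λ ()) All.∷ (λ ()) All.∷ All.[]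
stepSeqs-≢[] (suc L) =
  ++⁺ (prepended U (stepSeqs (suc L))) (++⁺ (prepended D (stepSeqs (suc L))) (prepended H (stepSeqs L)))
  where
  prepended : ∀ (s : Step) ps → All (_≢ []) (map (s ∷_) ps)
  prepended s ps = map⁺ (universal (λ _ ()) ps)

count : ℕ → ℤ → ℕ → ℕ → ℕ
count L h m k = sum (map (countedWeight h m k) (stepSeqs L))

count-firstStep : FirstStepRecurrence count
count-firstStep L h m k = begin
  sum (map w (map (U ∷_) A ++ map (D ∷_) A ++ map (H ∷_) B))
    ≡⟨ sum-map-++ w (map (U ∷_) A) _ ⟩
  sum (map w (map (U ∷_) A)) + sum (map w (map (D ∷_) A ++ map (H ∷_) B))
    ≡⟨ cong (sum (map w (map (U ∷_) A)) +_) (sum-map-++ w (map (D ∷_) A) _) ⟩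
  sum (map w (map (U ∷_) A)) + (sum (map w (map (D ∷_) A)) + sum (map w (map (H ∷_) B)))
    ≡⟨ +-assoc (sum (map w (map (U ∷_) A))) _ _ ⟨
  sum (map w (map (U ∷_) A)) + sum (map w (map (D ∷_) A)) + sum (map w (map (H ∷_) B))
    ≡⟨ cong₂ _+_ (cong₂ _+_ U-part D-part) H-part ⟩
  _ ∎
  where
  open ≡-Reasoning
  A = stepSeqs (suc L)
  B = stepSeqs L
  w = countedWeight h m k

  sum-prepend : ∀ s ps → sum (map w (map (s ∷_) ps)) ≡ sum (map (w ∘ (s ∷_)) ps)
  sum-prepend s ps = cong sum (sym (map-∘ ps))

  U-part : sum (map w (map (U ∷_) A)) ≡ xTimesIf (below h) (λ m′ → count (suc L) (h ℤ.+ 1ℤ) m′ k) m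
  U-part = trans (sum-prepend U A)
    (trans (cong sum (map-cong-local (All.map (countedWeight-U∷ h m k) (stepSeqs-≢[] L))))
      (sum-xTimesIf (below h) (λ m′ → countedWeight (h ℤ.+ 1ℤ) m′ k) m A))

  D-part : sum (map w (map (D ∷_) A)) ≡ xTimesIf (isZero h) (λ k′ → count (suc L) (h ℤ.+ -1ℤ) m k′) k
  D-part = trans (sum-prepend D A)
    (trans (cong sum (map-cong (countedWeight-D∷ h m k) A))
      (sum-xTimesIf (isZero h) (λ k′ → countedWeight (h ℤ.+ -1ℤ) m k′) k A))

  H-part : sum (map w (map (H ∷_) B)) ≡ xTimesIf (below h) (λ m′ → count L h m′ k) m
  H-part = trans (sum-prepend H B)
    (trans (cong sum (map-cong (countedWeight-H∷ h m k) B))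
      (sum-xTimesIf (below h) (λ m′ → countedWeight h m′ k) m B))

sum-map-filter : ∀ {A : Set} {P : A → Set} (P? : Decidable P) (f : A → ℕ) xs →
  sum (map f (filter P? xs)) ≡ sum (map (λ x → if does (P? x) then f x else 0) xs)
sum-map-filter P? f [] = refl
sum-map-filter P? f (x ∷ xs) with does (P? x)
... | true = cong (f x +_) (sum-map-filter P? f xs)
... | false = sum-map-filter P? f xs

if-∧ : ∀ x y (n : ℕ) → (if x ∧ y then n else 0) ≡ (if x then (if y then n else 0) else 0)
if-∧ true y n = refl
if-∧ false y n = refl

totalWeight≡count : ∀ n m k → totalWeight n m k ≡ count (2 * n) 0ℤ m k
totalWeight≡count n m k =
  trans (sum-map-filter _ weight (freeSchroeder n))
    (trans (sum-map-filter _ _ (stepSeqs (2 * n)))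
      (cong sum (map-cong selected (stepSeqs (2 * n)))))
  where
  selected : ∀ p → (if does (endHeight 0ℤ p ℤ.≟ 0ℤ)
                    then (if (flaws p ≡ᵇ m) ∧ (flawBlocks p ≡ᵇ k) then weight p else 0) else 0)
                   ≡ countedWeight 0ℤ m k p
  selected p = cong₂ (λ b w → if b then w else 0)
    (sym (isYes≗does (endHeight 0ℤ p ℤ.≟ 0ℤ)))
    (if-∧ (flaws p ≡ᵇ m) (flawBlocks p ≡ᵇ k) (weight p))

infixl 6 _∸?_

_∸?_ : ℕ → ℕ → Maybe ℕ
m ∸? zero = just m
zero ∸? suc k = nothing
suc m ∸? suc k = m ∸? k

pred? : Maybe ℕ → Maybe ℕ
pred? (just (suc q)) = just q
pred? _ = nothing

-- halfExcess d L ≡ just j exactly when L ≡ d + 2 * j.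
halfExcess : ℕ → ℕ → Maybe ℕ
halfExcess zero zero = just 0
halfExcess zero (suc zero) = nothing
halfExcess zero (suc (suc L)) = Maybe.map suc (halfExcess zero L)
halfExcess (suc d) zero = nothing
halfExcess (suc d) (suc L) = halfExcess d L

∸?-≤ : ∀ {m k} → k ≤ m → m ∸? k ≡ just (m ∸ k)
∸?-≤ {m} {zero} _ = refl
∸?-≤ {suc m} {suc k} (s≤s k≤m) = ∸?-≤ k≤m

pred?-suc-∸? : ∀ j m → pred? (suc j ∸? m) ≡ j ∸? m
pred?-suc-∸? j zero = refl
pred?-suc-∸? zero (suc zero) = refl
pred?-suc-∸? zero (suc (suc m)) = refl
pred?-suc-∸? (suc j) (suc m) = pred?-suc-∸? j m

pred?-∸? : ∀ m r → pred? (m ∸? r) ≡ m ∸? suc r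
pred?-∸? zero zero = refl
pred?-∸? zero (suc r) = refl
pred?-∸? (suc m) zero = refl
pred?-∸? (suc m) (suc r) = pred?-∸? m r

pred?-halfExcess : ∀ d L → pred? (halfExcess d (suc L)) ≡ halfExcess (suc d) L
pred?-halfExcess zero zero = refl
pred?-halfExcess zero (suc L) with halfExcess zero L
... | nothing = refl
... | just j = refl
pred?-halfExcess (suc zero) zero = refl
pred?-halfExcess (suc (suc d)) zero = refl
pred?-halfExcess (suc d) (suc L) = pred?-halfExcess d L

halfExcess-odd : ∀ L → halfExcess 0 (suc L) ≢ just 0
halfExcess-odd zero ()
halfExcess-odd (suc L) eq with halfExcess 0 L
halfExcess-odd (suc L) () | nothing
halfExcess-odd (suc L) () | just _

halfExcess-double : ∀ n → halfExcess 0 (2 * n) ≡ just n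
halfExcess-double zero = refl
halfExcess-double (suc n) rewrite +-suc n (n + 0) | halfExcess-double n = refl

∸?-nothing : ∀ m r {q} p → m ∸? r ≡ just (suc q) → p ≤ r → p ∸? m ≡ nothing
∸?-nothing zero zero p () p≤r
∸?-nothing (suc m) r zero eq p≤r = refl
∸?-nothing (suc m) (suc r) (suc p) eq (s≤s p≤r) = ∸?-nothing m r p eq p≤r

a? : Maybe ℕ → ℕ → ℕ
a? nothing r = 0
a? (just n) r = a n r

aPair? : Maybe ℕ → ℕ → ℕ
aPair? q r = a? q (suc r) + a? q r

a?-suc : ∀ y {x} → pred? y ≡ x → ∀ r → a? y (suc r) ≡ a? x (suc (suc r)) + a? y r + a? x (suc r)
a?-suc nothing refl r = refl
a?-suc (just zero) refl r = trans (a-zero (suc r)) (cong (_+ 0) (sym (a-zero r)))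
a?-suc (just (suc q)) refl r = a-suc-suc q r

aPair?-suc : ∀ y {x} → pred? y ≡ x → ∀ r →
  aPair? y (suc r) ≡ aPair? x (suc (suc r)) + aPair? y r + aPair? x (suc r)
aPair?-suc y {x} x≡ r = trans (cong₂ _+_ (a?-suc y x≡ (suc r)) (a?-suc y x≡ r))
  (regroup (a? x (3 + r)) (a? x (2 + r)) (a? x (suc r)) (a? y (suc r)) (a? y r))
  where
  regroup : ∀ x₃ x₂ x₁ y₁ y₀ →
            x₃ + y₁ + x₂ + (x₂ + y₀ + x₁) ≡ x₃ + x₂ + (y₁ + y₀) + (x₂ + x₁)
  regroup = solve-∀

*-aPair?-suc : ∀ c y {x} → pred? y ≡ x → ∀ r →
  c * aPair? y (suc r) ≡ c * aPair? x (suc (suc r)) + c * aPair? y r + c * aPair? x (suc r)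
*-aPair?-suc c y x≡ r = trans (cong (c *_) (aPair?-suc y x≡ r)) (distrib₃ c _ _ _)
  where
  distrib₃ : ∀ c u v w → c * (u + v + w) ≡ c * u + c * v + c * w
  distrib₃ = solve-∀

a?-suc-* : ∀ y {x} → pred? y ≡ x → ∀ r c →
  a? y (suc r) * c ≡ a? y r * c + a? x (suc (suc r)) * c + a? x (suc r) * c
a?-suc-* y {x} x≡ r c = trans (cong (_* c) (a?-suc y x≡ r)) (distrib₃ (a? x (2 + r)) (a? y r) (a? x (suc r)) c)
  where
  distrib₃ : ∀ u v w c → (u + v + w) * c ≡ v * c + u * c + w * c
  distrib₃ = solve-∀

-- Closed forms of count L h m k: formulaAbove d j for h = d ≥ 0 and L = d + 2j,
-- formulaBelow e j for h = -(e+1) and L = e + 1 + 2j.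
formulaAbove : ℕ → ℕ → ℕ → ℕ → ℕ
formulaAbove d j m (suc k) = a? (m ∸? suc k) (suc k) * aPair? (j ∸? m) (d + suc k)
formulaAbove d j zero zero = a j (suc d)
formulaAbove d j (suc m) zero = 0

formulaBelow : ℕ → ℕ → ℕ → ℕ → ℕ
formulaBelow e j m k = a? (m ∸? (suc e + k)) (suc e + k) * aPair? (suc (e + j) ∸? m) k

formulaAbove? : ℕ → Maybe ℕ → ℕ → ℕ → ℕ
formulaAbove? d nothing m k = 0
formulaAbove? d (just j) m k = formulaAbove d j m k

formulaBelow? : ℕ → Maybe ℕ → ℕ → ℕ → ℕ
formulaBelow? e nothing m k = 0
formulaBelow? e (just j) m k = formulaBelow e j m k

formula : ℕ → ℤ → ℕ → ℕ → ℕ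
formula L (ℤ.+ d) m k = formulaAbove? d (halfExcess d L) m k
formula L -[1+ e ] m k = formulaBelow? e (halfExcess (suc e) L) m k

formulaAbove?-suc : ∀ d y m k → formulaAbove? (suc d) y m k ≡
  formulaAbove? (suc (suc d)) (pred? y) m k + formulaAbove? d y m k + formulaAbove? (suc d) (pred? y) m k
formulaAbove?-suc d nothing m k = refl
formulaAbove?-suc d (just zero) zero (suc k) = refl
formulaAbove?-suc d (just zero) (suc m) (suc k) = sym (+-identityʳ _)
formulaAbove?-suc d (just zero) zero zero = trans (a-zero (2 + d)) (cong (_+ 0) (sym (a-zero (suc d))))
formulaAbove?-suc d (just zero) (suc m) zero = refl
formulaAbove?-suc d (just (suc j)) m (suc k) =
  *-aPair?-suc (a? (m ∸? suc k) (suc k)) (suc j ∸? m) (pred?-suc-∸? j m) (d + suc k)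
formulaAbove?-suc d (just (suc j)) zero zero = a-suc-suc j (suc d)
formulaAbove?-suc d (just (suc j)) (suc m) zero = refl

formulaAbove?-zero : ∀ y m k → formulaAbove? 0 (Maybe.map suc y) m k ≡
  formulaAbove? 1 y m k + xTimes (λ k′ → formulaBelow? 0 y m k′) k + formulaAbove? 0 y m k
formulaAbove?-zero nothing m k = cong (_+ 0) (sym (xTimes-0 k))
formulaAbove?-zero (just j) m (suc k) =
  *-aPair?-suc (a? (m ∸? suc k) (suc k)) (suc j ∸? m) (pred?-suc-∸? j m) k
formulaAbove?-zero (just j) zero zero = a-suc-suc j 0
formulaAbove?-zero (just j) (suc m) zero = refl

formulaBelow?-suc : ∀ e y m k → formulaBelow? (suc e) y m k ≡
  xTimes (λ m′ → formulaBelow? e y m′ k) m + formulaBelow? (suc (suc e)) (pred? y) m k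
    + xTimes (λ m′ → formulaBelow? (suc e) (pred? y) m′ k) m
formulaBelow?-suc e nothing m k = sym (cong₂ (λ x y → x + 0 + y) (xTimes-0 m) (xTimes-0 m))
formulaBelow?-suc e (just zero) zero k = refl
formulaBelow?-suc e (just zero) (suc m) k with m ∸? suc (e + k) in eq
... | nothing = refl
... | just zero rewrite a-zero (2 + (e + k)) | a-zero (suc (e + k)) = sym (trans (+-identityʳ _) (+-identityʳ _))
... | just (suc q)  -- then m > e + 1, so the second factor vanishes
  rewrite ∸?-nothing m (suc (e + k)) (suc (e + 0)) eq (s≤s (+-monoʳ-≤ e (z≤n {k}))) =
    trans (*-zeroʳ (a (suc q) (2 + (e + k)))) (sym (cong (λ z → z + 0 + 0) (*-zeroʳ (a (suc q) (suc (e + k))))))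
formulaBelow?-suc e (just (suc j)) zero k = refl
formulaBelow?-suc e (just (suc j)) (suc m) k rewrite +-suc e j =
  a?-suc-* (m ∸? suc (e + k)) (pred?-∸? m (suc (e + k))) (suc (e + k)) (aPair? (2 + (e + j) ∸? m) k)

formulaBelow?-zero : ∀ y → y ≢ just 0 → ∀ m k → formulaBelow? 0 y m k ≡
  xTimes (λ m′ → formulaAbove? 0 y m′ k) m + formulaBelow? 1 (pred? y) m k
    + xTimes (λ m′ → formulaBelow? 0 (pred? y) m′ k) m
formulaBelow?-zero nothing _ m k = sym (cong₂ (λ x y → x + 0 + y) (xTimes-0 m) (xTimes-0 m))
formulaBelow?-zero (just zero) y≢0 m k = ⊥-elim (y≢0 refl)
formulaBelow?-zero (just (suc j)) _ zero k = refl
formulaBelow?-zero (just (suc j)) _ (suc m) (suc k) =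
  a?-suc-* (m ∸? suc k) (pred?-∸? m (suc k)) (suc k) (aPair? (suc j ∸? m) (suc k))
formulaBelow?-zero (just (suc j)) _ (suc zero) zero = refl
formulaBelow?-zero (just (suc j)) _ (suc (suc m)) zero =
  a?-suc-* (just (suc m)) refl 0 (aPair? (suc j ∸? suc m) 0)

formula-firstStep : FirstStepRecurrence formula
formula-firstStep L (ℤ.+ zero) m k = formulaAbove?-zero (halfExcess 0 L) m k
formula-firstStep L (ℤ.+ suc d) m k rewrite +-comm d 1 | sym (pred?-halfExcess d L) =
  formulaAbove?-suc d (halfExcess d (suc L)) m k
formula-firstStep L -[1+ zero ] m k rewrite sym (pred?-halfExcess 0 L) =
  formulaBelow?-zero (halfExcess 0 (suc L)) (halfExcess-odd L) m k
formula-firstStep L -[1+ suc e ] m k rewrite +-identityʳ e | sym (pred?-halfExcess (suc e) L) =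
  formulaBelow?-suc e (halfExcess (suc e) (suc L)) m k

count≡formula-0 : ∀ h m k → count 0 h m k ≡ formula 0 h m k
count≡formula-0 (ℤ.+ zero) zero zero = refl
count≡formula-0 (ℤ.+ zero) zero (suc k) = refl
count≡formula-0 (ℤ.+ zero) (suc m) zero = refl
count≡formula-0 (ℤ.+ zero) (suc m) (suc k) = sym (*-zeroʳ (a? (suc m ∸? suc k) (suc k)))
count≡formula-0 (ℤ.+ suc d) m k = refl
count≡formula-0 -[1+ e ] m k = refl

count≡formula-1 : ∀ h m k → count 1 h m k ≡ formula 1 h m k
count≡formula-1 (ℤ.+ zero) m k = refl
count≡formula-1 (ℤ.+ suc zero) zero zero = refl
count≡formula-1 (ℤ.+ suc zero) zero (suc k) = refl
count≡formula-1 (ℤ.+ suc zero) (suc m) zero = refl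
count≡formula-1 (ℤ.+ suc zero) (suc m) (suc k) = sym (*-zeroʳ (a? (suc m ∸? suc k) (suc k)))
count≡formula-1 (ℤ.+ suc (suc d)) m k = refl
count≡formula-1 -[1+ zero ] zero k = refl
count≡formula-1 -[1+ zero ] (suc zero) zero = refl
count≡formula-1 -[1+ zero ] (suc zero) (suc k) = refl
count≡formula-1 -[1+ zero ] (suc (suc m)) k = sym (*-zeroʳ (a? (suc m ∸? k) (suc k)))
count≡formula-1 -[1+ suc e ] m k = refl

count≡formula : ∀ L h m k → count L h m k ≡ formula L h m k
count≡formula = firstStepRecurrence-determined count-firstStep formula-firstStep count≡formula-0 count≡formula-1

formula-origin : ∀ {n m k} → suc k ≤ m → m ≤ n →
  formula (2 * n) 0ℤ m (suc k) ≡ a (m ∸ suc k) (suc k) * (a (n ∸ m) (2 + k) + a (n ∸ m) (suc k))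
formula-origin {n} k<m m≤n rewrite halfExcess-double n | ∸?-≤ k<m | ∸?-≤ m≤n = refl

corollary3p10 : (n m k : ℕ) → 0 < k → k ≤ m → m ≤ n →
    totalWeight n m k ≡ a (m ∸ k) k * (a (n ∸ m) (k + 1) + a (n ∸ m) k)
corollary3p10 n m (suc k) _ k≤m m≤n = begin
  totalWeight n m (suc k)           ≡⟨ totalWeight≡count n m (suc k) ⟩
  count (2 * n) 0ℤ m (suc k)        ≡⟨ count≡formula (2 * n) 0ℤ m (suc k) ⟩
  formula (2 * n) 0ℤ m (suc k)      ≡⟨ formula-origin k≤m m≤n ⟩
  a (m ∸ suc k) (suc k) * (a (n ∸ m) (2 + k) + a (n ∸ m) (suc k))
    ≡⟨ cong (λ r → a (m ∸ suc k) (suc k) * (a (n ∸ m) r + a (n ∸ m) (suc k))) (cong suc (+-comm 1 k)) ⟩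
  a (m ∸ suc k) (suc k) * (a (n ∸ m) (suc k + 1) + a (n ∸ m) (suc k)) ∎
  where open ≡-Reasoning
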